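{- Let $\bar V$ be a finite set with $|\bar V|=\bar n$ and consider the complete bipartite graph between $\bar V$ and $[\bar n]=\{1,\dots,\bar n\}$. Let $\bar A,\bar B\subseteq\bar V$ and let $M_{\bar A},M_{\bar B}:\bar V\to[\bar n]$ be two bijections (perfect matchings) such that: (a) for every $v\in\bar V\setminus(\bar A\triangle\bar B)$ we have $|M_{\bar A}(v)-M_{\bar B}(v)|\le 1$; (b) for every $v\in\bar A\setminus\bar B$ we have $M_{\bar A}(v)\le M_{\bar B}(v)$, and for every $v\in\bar B\setminus\bar A$ we have $M_{\bar B}(v)\le M_{\bar A}(v)$; (c) there do not exist $v_1,v_2\in\bar A\triangle\bar B$ with $\min\{M_{\bar A}(v_1),M_{\bar B}(v_1)\}<\min\{M_{\bar A}(v_2),M_{\bar B}(v_2)\}$ and $\max\{M_{\bar A}(v_1),M_{\bar B}(v_1)\}>\max\{M_{\bar A}(v_2),M_{\bar B}(v_2)\}$. Then for every cycle $C$ in the symmetric difference $M_{\bar A}\triangle M_{\bar B}$ (of the edge sets $\{v M_{\bar A}(v)\}$ and $\{vM_{\bar B}(v)\}$) we have $\big||\bar A\cap C|-|\bar B\cap C|\big|\le 1$, where $|\bar A\cap C|$ denotes the number of vertices of $\bar A$ on $C$. -}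

module Defs where

open import Data.Nat using (ℕ; zero; suc; _≤_; _<_; _⊓_; _⊔_; ∣_-_∣)
open import Data.Nat.DivMod using (_mod_)
open import Data.Fin using (Fin; toℕ)
open import Data.Fin.Subset using (Subset; _∈_; _∉_)
open import Data.Fin.Subset.Properties using (_∈?_)
open import Data.List using (length; filter)
open import Data.Product using (_×_; _,_)
open import Data.Sum using (_⊎_)
open import Relation.Binary.PropositionalEquality using (_≡_; _≢_)
open import Relation.Nullary using (¬_)
open import Function.Definitions using (Injective)
open import Data.List using (allFin)

-- Vertex set V̄ is modelled as Fin n, the other side [n] as Fin n
-- (element i of Fin n stands for i+1 ∈ [n]; only differences and
-- order comparisons are used, so the shift is irrelevant).

_∈△_ : ∀ {n} → Fin n → Subset n × Subset n → Set
v ∈△ (A , B) = (v ∈ A × v ∉ B) ⊎ (v ∈ B × v ∉ A)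

InSymDiffEdge : ∀ {n} → (MA MB : Fin n → Fin n) → Fin n → Fin n → Set
InSymDiffEdge MA MB v w = (MA v ≡ w × MB v ≢ w) ⊎ (MB v ≡ w × MA v ≢ w)

next : ∀ {k} → Fin k → Fin k
next {suc k} i = suc (toℕ i) mod (suc k)

-- A cycle in a bipartite graph between V̄ = Fin n and [n] = Fin n with
-- edge relation E: v₀ w₀ v₁ w₁ … v_{k-1} w_{k-1} v₀, all vertices distinct,
-- k ≥ 2 (so the cycle has length 2k ≥ 4).
record Cycle {n : ℕ} (E : Fin n → Fin n → Set) : Set where
  field
    k      : ℕ
    k≥2    : 2 ≤ k
    vs     : Fin k → Fin n
    ws     : Fin k → Fin n
    vs-inj : Injective _≡_ _≡_ vs
    ws-inj : Injective _≡_ _≡_ ws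
    edge₁  : ∀ i → E (vs i) (ws i)
    edge₂  : ∀ i → E (vs (next i)) (ws i)

countIn : ∀ {n} {E : Fin n → Fin n → Set} → Subset n → Cycle E → ℕ
countIn S C = length (filter (λ i → vs i ∈? S) (allFin k))
  where open Cycle C

-- Write the cycle as v₀ w₀ v₁ w₁ … and orient it so that each vᵢ is entered through its M-edge and left
-- through its M′-edge, where {M, M′} = {M_A, M_B}. Then xᵢ = M(vᵢ) is a closed walk through distinct points
-- of [n] whose i-th step goes from M(vᵢ) to M′(vᵢ). By (a) and (b), the steps at vertices outside A △ B
-- move by one, while the "long" steps at A △ B ascend at A ∖ B and descend at B ∖ A (or the other way
-- round); by (c) the intervals of the long steps are pairwise non-nested. So it suffices that such a walk has as many
-- ascending as descending long steps, up to one.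
--
-- Rank the long steps lexicographically by (max, min) of their intervals; by non-nestedness this is also
-- the (min, max) order. In rank order the long steps alternately ascend and descend, which gives the bound.
-- Alternation follows from the potential Φ(s) = parity of ρ(s) + [s ascends], where ρ(s) is the rank of a
-- long step s and L(max s) for a unit step s, L(t) counting the long steps that start below t. Φ agrees on
-- the two steps meeting at any point t of the walk: both ρ-values differ from L(t) by a correction read off
-- from these two steps alone, because the rank of a long step can be computed from either end of its
-- interval, and because L(t) has the parity of R(t) (the long steps ending below t) plus the number of unit
-- steps crossing t - 1/2, as a closed walk crosses every cut an even number of times.

module Submission where

open import Defs
open import Algebra.Properties.CommutativeMonoid.Sum as MonoidSum using ()
open import Data.Bool using (Bool; true; false; not; _∧_; _xor_; if_then_else_) renaming (_≟_ to _≟ᵇ_)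
open import Data.Bool.Properties using (∧-zeroʳ; ∧-identityʳ)
open import Data.Fin using (Fin; zero; suc; toℕ; inject₁; fromℕ; punchIn) renaming (_≟_ to _≟ᶠ_)
open import Data.Fin.Induction using (<-weakInduction)
open import Data.Fin.Properties
  using (toℕ<n; toℕ-fromℕ<; toℕ-injective; toℕ-fromℕ; toℕ-inject₁; punchInᵢ≢i; any?)
import Data.Fin.Properties as Finₚ
open import Data.Fin.Relation.Unary.Top using (view; ‵fromℕ; ‵inject₁)
open import Data.Fin.Subset using (Subset; _∈_; _∉_)
open import Data.Fin.Subset.Properties using (_∈?_)
open import Data.List using (length; filter; tabulate)
open import Data.Nat
  using (ℕ; zero; suc; _+_; _*_; _≤_; _<_; _>_; _⊓_; _⊔_; ∣_-_∣; z≤n; s≤s; s≤s⁻¹; _<?_; _≟_; parity)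
open import Data.Nat.DivMod using (_%_; m<n⇒m%n≡m; n%n≡0)
open import Data.Nat.Properties
open import Data.Parity using (Parity; 0ℙ; 1ℙ; _⁻¹) renaming (_+_ to _+ℙ_)
open import Data.Parity.Properties
  using (p+p≡0ℙ; +-homo-+) renaming (_≟_ to _≟ℙ_; +-identityʳ to +ℙ-identityʳ)
open import Data.Product using (_×_; _,_; proj₁; proj₂; ∃-syntax; uncurry)
open import Data.Sum using (_⊎_; inj₁; inj₂; [_,_]′)
import Data.Sum as Sum
open import Function using (_∘_; id)
open import Function.Definitions using (Injective; Bijective)
open import Relation.Binary using (tri<; tri≈; tri>)
open import Relation.Binary.PropositionalEquality
  using (_≡_; _≢_; refl; sym; trans; cong; cong₂; subst; subst₂; module ≡-Reasoning)
open import Relation.Nullary using (¬_; Dec; yes; no; does; contradiction)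
open import Relation.Nullary.Decidable using (dec-true; dec-false; _×-dec_)
open import Relation.Unary using (Decidable)

open MonoidSum +-0-commutativeMonoid
  using (sum; sum-cong-≗; ∑-distrib-+; sum-replicate-zero; sum-remove; sum-init-last)

ind : Bool → ℕ
ind false = 0
ind true  = 1

count : ∀ {k} → (Fin k → Bool) → ℕ
count p = sum (ind ∘ p)

count-cong : ∀ {k} {p q : Fin k → Bool} → (∀ i → p i ≡ q i) → count p ≡ count q
count-cong p≗q = sum-cong-≗ (cong ind ∘ p≗q)

count-split : ∀ {k} (p q r : Fin k → Bool) →
              (∀ i → ind (p i) ≡ ind (q i) + ind (r i)) → count p ≡ count q + count r
count-split p q r split = trans (sum-cong-≗ split) (∑-distrib-+ (ind ∘ q) (ind ∘ r))

count-+-cong : ∀ {k} (p q p′ q′ : Fin k → Bool) → (∀ i → ind (p i) + ind (q i) ≡ ind (p′ i) + ind (q′ i)) →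
               count p + count q ≡ count p′ + count q′
count-+-cong p q p′ q′ pointwise = begin
  count p + count q                    ≡⟨ sym (∑-distrib-+ (ind ∘ p) (ind ∘ q)) ⟩
  sum (λ i → ind (p i) + ind (q i))    ≡⟨ sum-cong-≗ pointwise ⟩
  sum (λ i → ind (p′ i) + ind (q′ i))  ≡⟨ ∑-distrib-+ (ind ∘ p′) (ind ∘ q′) ⟩
  count p′ + count q′                  ∎
  where open ≡-Reasoning

count-none : ∀ {k} (p : Fin k → Bool) → (∀ i → p i ≡ false) → count p ≡ 0
count-none {k} p none = trans (count-cong none) (sum-replicate-zero k)

count-single : ∀ {k} (p : Fin k → Bool) s → (∀ i → i ≢ s → p i ≡ false) → count p ≡ ind (p s)
count-single {suc _} p s only-s = begin
  count p                            ≡⟨ sum-remove {i = s} (ind ∘ p) ⟩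
  ind (p s) + count (p ∘ punchIn s)  ≡⟨ cong (ind (p s) +_) (count-none _ (only-s _ ∘ punchInᵢ≢i s)) ⟩
  ind (p s) + 0                      ≡⟨ +-identityʳ _ ⟩
  ind (p s)                          ∎
  where open ≡-Reasoning

ind-split-by : ∀ d c → ind c ≡ ind (d ∧ c) + ind (not d ∧ c)
ind-split-by true  c = sym (+-identityʳ (ind c))
ind-split-by false c = refl

∧-ind-split : ∀ d {c c₁ c₂} → ind c ≡ ind c₁ + ind c₂ → ind (d ∧ c) ≡ ind (d ∧ c₁) + ind (d ∧ c₂)
∧-ind-split false _     = refl
∧-ind-split true  split = split

count-pair : ∀ {k} (p : Fin k → Bool) {s o} → s ≢ o → (∀ i → i ≢ s → i ≢ o → p i ≡ false) →
             count p ≡ ind (p s) + ind (p o)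
count-pair p {s} {o} s≢o only-s-o = begin
  count p                       ≡⟨ count-split p at-s off-s (λ i → ind-split-by (does (i ≟ᶠ s)) (p i)) ⟩
  count at-s + count off-s      ≡⟨ cong₂ _+_ (count-single at-s s at-s-only) (count-single off-s o off-s-only) ⟩
  ind (at-s s) + ind (off-s o)  ≡⟨ cong₂ (λ a b → ind (a ∧ p s) + ind (not b ∧ p o))
                                         (dec-true (s ≟ᶠ s) refl) (dec-false (o ≟ᶠ s) (s≢o ∘ sym)) ⟩
  ind (p s) + ind (p o)         ∎
  where
  open ≡-Reasoning
  at-s off-s : _ → Bool
  at-s  i = does (i ≟ᶠ s) ∧ p i
  off-s i = not (does (i ≟ᶠ s)) ∧ p i
  at-s-only : ∀ i → i ≢ s → at-s i ≡ false
  at-s-only i i≢s = cong (_∧ p i) (dec-false (i ≟ᶠ s) i≢s)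
  off-s-only : ∀ i → i ≢ o → off-s i ≡ false
  off-s-only i i≢o with i ≟ᶠ s
  ... | yes _   = refl
  ... | no  i≢s = only-s-o i i≢s i≢o

next-inject₁ : ∀ {m} (i : Fin m) → next (inject₁ i) ≡ suc i
next-inject₁ {m} i = toℕ-injective (begin
  toℕ (next (inject₁ i))         ≡⟨ toℕ-fromℕ< _ ⟩
  suc (toℕ (inject₁ i)) % suc m  ≡⟨ cong (λ n → suc n % suc m) (toℕ-inject₁ i) ⟩
  suc (toℕ i) % suc m            ≡⟨ m<n⇒m%n≡m (s≤s (toℕ<n i)) ⟩
  suc (toℕ i)                    ∎)
  where open ≡-Reasoning

next-fromℕ : ∀ m → next (fromℕ m) ≡ zero
next-fromℕ m = toℕ-injective (begin
  toℕ (next (fromℕ m))         ≡⟨ toℕ-fromℕ< _ ⟩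
  suc (toℕ (fromℕ m)) % suc m  ≡⟨ cong (λ n → suc n % suc m) (toℕ-fromℕ m) ⟩
  suc m % suc m                ≡⟨ n%n≡0 (suc m) ⟩
  0                            ∎)
  where open ≡-Reasoning

next-injective : ∀ {k} {i j : Fin k} → next i ≡ next j → i ≡ j
next-injective {suc m} {i} {j} eq with view i | view j
... | ‵fromℕ      | ‵fromℕ      = refl
... | ‵fromℕ      | ‵inject₁ j′ with () ← trans (sym (next-fromℕ m)) (trans eq (next-inject₁ j′))
... | ‵inject₁ i′ | ‵fromℕ      with () ← trans (sym (next-fromℕ m)) (trans (sym eq) (next-inject₁ i′))
... | ‵inject₁ i′ | ‵inject₁ j′ =
  cong inject₁ (Finₚ.suc-injective (trans (sym (next-inject₁ i′)) (trans eq (next-inject₁ j′))))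

next-irreflexive : ∀ {k} → 2 ≤ k → (i : Fin k) → next i ≢ i
next-irreflexive {suc zero}    (s≤s ()) _
next-irreflexive {suc (suc m)} _ i eq with view i
... | ‵fromℕ with () ← trans (sym (next-fromℕ (suc m))) eq
... | ‵inject₁ i′ = 1+n≢n (trans (cong toℕ (trans (sym (next-inject₁ i′)) eq)) (toℕ-inject₁ i′))

next²-irreflexive : ∀ {m} (i : Fin (3 + m)) → next (next i) ≢ i
next²-irreflexive {m} i eq with view i
... | ‵fromℕ with () ← trans (sym (trans (cong next (next-fromℕ (2 + m))) (next-inject₁ zero))) eq
... | ‵inject₁ i′ with view i′
...   | ‵fromℕ with () ← trans (sym (trans (cong next (next-inject₁ i′)) (next-fromℕ (2 + m)))) eq
...   | ‵inject₁ i″ = <⇒≢ (<-trans (n<1+n _) (n<1+n _)) (sym (begin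
  suc (suc (toℕ i″))          ≡⟨ cong toℕ (trans (sym (trans (cong next (next-inject₁ (inject₁ i″)))
                                                              (next-inject₁ (suc i″)))) eq) ⟩
  toℕ (inject₁ (inject₁ i″))  ≡⟨ trans (toℕ-inject₁ (inject₁ i″)) (toℕ-inject₁ i″) ⟩
  toℕ i″                      ∎))
  where open ≡-Reasoning

next-induction : ∀ {m} (P : Fin (suc m) → Set) → P zero → (∀ i → P i → P (next i)) → ∀ i → P i
next-induction P P₀ step = <-weakInduction P P₀ (λ i Pᵢ → subst P (next-inject₁ i) (step _ Pᵢ))

next-invariant-choice : ∀ {k} (F G : Fin k → Set) → (∀ j → F j ⊎ G j) →
                        (∀ j → F j → F (next j)) → (∀ j → G j → G (next j)) → (∀ j → F j) ⊎ (∀ j → G j)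
next-invariant-choice {zero}  F G _ _ _ = inj₁ (λ ())
next-invariant-choice {suc m} F G F-or-G F-step G-step with F-or-G zero
... | inj₁ F₀ = inj₁ (next-induction F F₀ F-step)
... | inj₂ G₀ = inj₂ (next-induction G G₀ G-step)

count-rotate : ∀ {m} (p : Fin (suc m) → Bool) → count (p ∘ next) ≡ count p
count-rotate {m} p = begin
  count (p ∘ next)                                       ≡⟨ sum-init-last (ind ∘ p ∘ next) ⟩
  count (p ∘ next ∘ inject₁) + ind (p (next (fromℕ m)))  ≡⟨ cong₂ _+_ (count-cong (cong p ∘ next-inject₁))
                                                                      (cong (ind ∘ p) (next-fromℕ m)) ⟩
  count (p ∘ suc) + ind (p zero)                         ≡⟨ +-comm _ (ind (p zero)) ⟩
  count p                                                ∎
  where open ≡-Reasoning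

-- Ranks and their parities

upper-bound : ∀ {k} (f : Fin k → ℕ) → ∃[ T ] (∀ i → f i < T)
upper-bound {zero}  f = 0 , λ ()
upper-bound {suc k} f with T , f∘suc<T ← upper-bound (f ∘ suc) =
  suc (f zero) ⊔ T , λ { zero    → m≤m⊔n (suc (f zero)) T
                       ; (suc i) → <-≤-trans (f∘suc<T i) (m≤n⊔m (suc (f zero)) T) }

ind-<-suc : ∀ a t → ind (does (a <? suc t)) ≡ ind (does (a <? t)) + ind (does (a ≟ t))
ind-<-suc a t with <-cmp a t
... | tri< a<t a≢t _
  rewrite dec-true (a <? suc t) (m<n⇒m<1+n a<t) | dec-true (a <? t) a<t | dec-false (a ≟ t) a≢t = refl
... | tri≈ _ refl _
  rewrite dec-true (a <? suc a) (n<1+n a) | dec-false (a <? a) (n≮n a) | dec-true (a ≟ a) refl = refl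
... | tri> a≮t a≢t _
  rewrite dec-false (a <? suc t) (λ a<1+t → a≮t (≤∧≢⇒< (s≤s⁻¹ a<1+t) a≢t))
        | dec-false (a <? t) a≮t | dec-false (a ≟ t) a≢t = refl

Balanced : ℕ → ℕ → Parity → Set
Balanced r₀ r₁ 0ℙ = r₀ ≡ r₁
Balanced r₀ r₁ 1ℙ = r₀ ≡ suc r₁

Balanced-suc : ∀ {n n′ r₀ r₀′ r₁ r₁′} → n′ ≡ n + 1 →
               r₀′ ≡ r₀ + ind (does (parity n ≟ℙ 0ℙ)) → r₁′ ≡ r₁ + ind (does (parity n ≟ℙ 1ℙ)) →
               Balanced r₀ r₁ (parity n) → Balanced r₀′ r₁′ (parity n′)
Balanced-suc {n} {r₀ = r₀} {r₁ = r₁} refl refl refl bal rewrite +-homo-+ n 1 with parity n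
... | 0ℙ = trans (+-comm r₀ 1) (cong suc (trans bal (sym (+-identityʳ r₁))))
... | 1ℙ = trans (+-identityʳ r₀) (trans bal (+-comm 1 r₁))

Balanced⇒∣-∣≤1 : ∀ {r₀ r₁} π → Balanced r₀ r₁ π → ∣ r₀ - r₁ ∣ ≤ 1
Balanced⇒∣-∣≤1 {r₀}      0ℙ refl = ≤-trans (≤-reflexive (∣n-n∣≡0 r₀)) z≤n
Balanced⇒∣-∣≤1 {r₁ = r₁} 1ℙ refl = ≤-reflexive (begin
  ∣ suc r₁ - r₁ ∣   ≡⟨ ∣-∣-comm (suc r₁) r₁ ⟩
  ∣ r₁ - suc r₁ ∣   ≡⟨ cong (∣ r₁ -_∣) (+-comm 1 r₁) ⟩
  ∣ r₁ - r₁ + 1 ∣   ≡⟨ ∣m-m+n∣≡n r₁ 1 ⟩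
  1                 ∎)
  where open ≡-Reasoning

module RankParity {k} (D : Fin k → Bool) (key : Fin k → ℕ)
  (key-injective : ∀ {i j} → D i ≡ true → D j ≡ true → key i ≡ key j → i ≡ j) where

  Refines : (Fin k → Bool) → Set
  Refines g = ∀ i → g i ≡ true → D i ≡ true

  countBelow countAt : (Fin k → Bool) → ℕ → ℕ
  countBelow g t = count (λ i → g i ∧ does (key i <? t))
  countAt    g t = count (λ i → g i ∧ does (key i ≟ t))

  below : ℕ → ℕ
  below = countBelow D

  rank : Fin k → ℕ
  rank i = below (key i)

  ofParity : Parity → Fin k → Bool
  ofParity π i = D i ∧ does (parity (rank i) ≟ℙ π)

  ofParity-refines : ∀ π → Refines (ofParity π)
  ofParity-refines π i with D i
  ... | true = λ _ → refl

  countBelow-zero : ∀ g → countBelow g 0 ≡ 0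
  countBelow-zero g = count-none _ (λ i → trans (cong (g i ∧_) (dec-false (key i <? 0) n≮0)) (∧-zeroʳ (g i)))

  countBelow-suc : ∀ g t → countBelow g (suc t) ≡ countBelow g t + countAt g t
  countBelow-suc g t = count-split _ _ _ (λ i → ∧-ind-split (g i) (ind-<-suc (key i) t))

  data KeyAt (t : ℕ) : Set where
    none : (∀ g → Refines g → countAt g t ≡ 0) → KeyAt t
    one  : ∀ i₀ → D i₀ ≡ true → key i₀ ≡ t → (∀ g → Refines g → countAt g t ≡ ind (g i₀)) → KeyAt t

  keyAt : ∀ t → KeyAt t
  keyAt t with any? (λ i → (D i ≟ᵇ true) ×-dec (key i ≟ t))
  ... | no ∄i = none λ g g⊆D → count-none _ (miss g g⊆D)
    where
    miss : ∀ g → Refines g → ∀ i → g i ∧ does (key i ≟ t) ≡ false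
    miss g g⊆D i with g i in gᵢ
    ... | false = refl
    ... | true  = dec-false (key i ≟ t) (λ kᵢ≡t → ∄i (i , g⊆D i gᵢ , kᵢ≡t))
  ... | yes (i₀ , Di₀ , kᵢ₀≡t) = one i₀ Di₀ kᵢ₀≡t λ g g⊆D → begin
    countAt g t                     ≡⟨ count-single _ i₀ (miss g g⊆D) ⟩
    ind (g i₀ ∧ does (key i₀ ≟ t))  ≡⟨ cong (λ b → ind (g i₀ ∧ b)) (dec-true (key i₀ ≟ t) kᵢ₀≡t) ⟩
    ind (g i₀ ∧ true)               ≡⟨ cong ind (∧-identityʳ (g i₀)) ⟩
    ind (g i₀)                      ∎
    where
    open ≡-Reasoning
    miss : ∀ g → Refines g → ∀ i → i ≢ i₀ → g i ∧ does (key i ≟ t) ≡ false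
    miss g g⊆D i i≢i₀ with g i in gᵢ
    ... | false = refl
    ... | true  = dec-false (key i ≟ t)
                            (λ kᵢ≡t → i≢i₀ (key-injective (g⊆D i gᵢ) Di₀ (trans kᵢ≡t (sym kᵢ₀≡t))))

  balanced : ∀ t → Balanced (countBelow (ofParity 0ℙ) t) (countBelow (ofParity 1ℙ) t) (parity (below t))
  balanced zero rewrite countBelow-zero D | countBelow-zero (ofParity 0ℙ) | countBelow-zero (ofParity 1ℙ) = refl
  balanced (suc t) with keyAt t
  ... | none no-key
    rewrite countBelow-suc D t | countBelow-suc (ofParity 0ℙ) t | countBelow-suc (ofParity 1ℙ) t
          | no-key D (λ _ → id)
          | no-key (ofParity 0ℙ) (ofParity-refines 0ℙ) | no-key (ofParity 1ℙ) (ofParity-refines 1ℙ)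
          | +-identityʳ (below t)
          | +-identityʳ (countBelow (ofParity 0ℙ) t) | +-identityʳ (countBelow (ofParity 1ℙ) t)
          = balanced t
  ... | one i₀ Di₀ kᵢ₀≡t only-i₀ = Balanced-suc (step D (λ _ → id) (cong ind Di₀))
                                                (step (ofParity 0ℙ) (ofParity-refines 0ℙ) (cong ind (at-i₀ 0ℙ)))
                                                (step (ofParity 1ℙ) (ofParity-refines 1ℙ) (cong ind (at-i₀ 1ℙ)))
                                                (balanced t)
    where
    step : ∀ g → Refines g → ∀ {n} → ind (g i₀) ≡ n → countBelow g (suc t) ≡ countBelow g t + n
    step g g⊆D gᵢ₀ = trans (countBelow-suc g t) (cong (_ +_) (trans (only-i₀ g g⊆D) gᵢ₀))
    at-i₀ : ∀ π → ofParity π i₀ ≡ does (parity (below t) ≟ℙ π)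
    at-i₀ π = cong₂ (λ d k → d ∧ does (parity (below k) ≟ℙ π)) Di₀ kᵢ₀≡t

  withRankParity : Parity → ℕ
  withRankParity π = count (ofParity π)

  rank-parities-balanced : ∣ withRankParity 0ℙ - withRankParity 1ℙ ∣ ≤ 1
  rank-parities-balanced with T , key<T ← upper-bound key =
    subst₂ (λ r₀ r₁ → ∣ r₀ - r₁ ∣ ≤ 1) (all-below 0ℙ) (all-below 1ℙ)
           (Balanced⇒∣-∣≤1 (parity (below T)) (balanced T))
    where
    all-below : ∀ π → countBelow (ofParity π) T ≡ withRankParity π
    all-below π = count-cong (λ i → trans (cong (ofParity π i ∧_) (dec-true (key i <? T) (key<T i)))
                                          (∧-identityʳ _))

+-does-< : ∀ a {m n} → does (a + m <? a + n) ≡ does (m <? n)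
+-does-< a {m} {n} with m <? n
... | yes m<n = trans (dec-true (a + m <? a + n) (+-monoʳ-< a m<n)) (sym (dec-true (m <? n) m<n))
... | no  m≮n = trans (dec-false (a + m <? a + n) (m≮n ∘ +-cancelˡ-< a m n)) (sym (dec-false (m <? n) m≮n))

<?-flip : ∀ {m n} → m ≢ n → does (n <? m) ≡ not (does (m <? n))
<?-flip {m} {n} m≢n with <-cmp m n
... | tri< m<n _ _   rewrite dec-true (m <? n) m<n | dec-false (n <? m) (<⇒≯ m<n) = refl
... | tri≈ _ m≡n _   = contradiction m≡n m≢n
... | tri> m≮n _ n<m rewrite dec-false (m <? n) m≮n | dec-true (n <? m) n<m = refl

∧-≟-miss : ∀ a {e t} c → e ≢ t → a ∧ does (e ≟ t) ∧ c ≡ false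
∧-≟-miss a {e} {t} c e≢t rewrite dec-false (e ≟ t) e≢t = ∧-zeroʳ a

∧-<-irrefl : ∀ a b n → a ∧ b ∧ does (n <? n) ≡ false
∧-<-irrefl a b n rewrite dec-false (n <? n) (n≮n n) | ∧-zeroʳ b = ∧-zeroʳ a

∣m-n∣≤1⇒m⊔n≡1+m⊓n : ∀ m n → m ≢ n → ∣ m - n ∣ ≤ 1 → m ⊔ n ≡ suc (m ⊓ n)
∣m-n∣≤1⇒m⊔n≡1+m⊓n zero          zero          m≢n _     = contradiction refl m≢n
∣m-n∣≤1⇒m⊔n≡1+m⊓n zero          (suc zero)    _   _     = refl
∣m-n∣≤1⇒m⊔n≡1+m⊓n (suc zero)    zero          _   _     = refl
∣m-n∣≤1⇒m⊔n≡1+m⊓n (suc m)       (suc n)       m≢n m-n≤1 =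
  cong suc (∣m-n∣≤1⇒m⊔n≡1+m⊓n m n (m≢n ∘ cong suc) m-n≤1)
∣m-n∣≤1⇒m⊔n≡1+m⊓n zero          (suc (suc n)) _   (s≤s ())
∣m-n∣≤1⇒m⊔n≡1+m⊓n (suc (suc m)) zero          _   (s≤s ())

square-pairing-mono : ∀ {h h′ l l′} → l ≤ h → h < h′ → h * h + l < h′ * h′ + l′
square-pairing-mono {h} {h′} {l} {l′} l≤h h<h′ = begin-strict
  h * h + l              ≤⟨ +-monoʳ-≤ (h * h) l≤h ⟩
  h * h + h              ≡⟨ +-comm (h * h) h ⟩
  h + h * h              <⟨ s≤s (m≤n+m (h + h * h) h) ⟩
  suc (h + (h + h * h))  ≡⟨ cong (λ n → suc (h + n)) (sym (*-suc h h)) ⟩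
  suc h * suc h          ≤⟨ *-mono-≤ h<h′ h<h′ ⟩
  h′ * h′                ≤⟨ m≤m+n (h′ * h′) l′ ⟩
  h′ * h′ + l′           ∎
  where open ≤-Reasoning

square-pairing-< : ∀ {h h′ l l′} → l ≤ h → l′ ≤ h′ →
                   ind (does (h′ * h′ + l′ <? h * h + l)) ≡
                   ind (does (h′ <? h)) + ind (does (h′ ≟ h) ∧ does (l′ <? l))
square-pairing-< {h} {h′} {l} {l′} l≤h l′≤h′ with <-cmp h′ h
... | tri< h′<h h′≢h _
  rewrite dec-true (h′ * h′ + l′ <? h * h + l) (square-pairing-mono l′≤h′ h′<h)
        | dec-true (h′ <? h) h′<h | dec-false (h′ ≟ h) h′≢h = refl
... | tri≈ _ refl _
  rewrite +-does-< (h * h) {l′} {l} | dec-false (h <? h) (n≮n h) | dec-true (h ≟ h) refl = refl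
... | tri> h′≮h h′≢h h<h′
  rewrite dec-false (h′ * h′ + l′ <? h * h + l) (<⇒≯ (square-pairing-mono l≤h h<h′))
        | dec-false (h′ <? h) h′≮h | dec-false (h′ ≟ h) h′≢h = refl

square-pairing-injective : ∀ {h h′ l l′} → l ≤ h → l′ ≤ h′ →
                           h * h + l ≡ h′ * h′ + l′ → h ≡ h′ × l ≡ l′
square-pairing-injective {h} {h′} l≤h l′≤h′ eq with <-cmp h h′
... | tri< h<h′ _ _ = contradiction eq (<⇒≢ (square-pairing-mono l≤h h<h′))
... | tri≈ _ refl _ = refl , +-cancelˡ-≡ (h * h) _ _ eq
... | tri> _ _ h′<h = contradiction (sym eq) (<⇒≢ (square-pairing-mono l′≤h′ h′<h))

unnested-lex-swap : ∀ {h h′ l l′} → ¬ (l′ < l × h < h′) → ¬ (l < l′ × h′ < h) →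
                    ind (does (h′ <? h)) + ind (does (h′ ≟ h) ∧ does (l′ <? l)) ≡
                    ind (does (l′ <? l)) + ind (does (l′ ≟ l) ∧ does (h′ <? h))
unnested-lex-swap {h} {h′} {l} {l′} ¬l′<l<h<h′ ¬l<l′<h′<h with <-cmp h′ h | <-cmp l′ l
... | tri< h′<h h′≢h _ | tri< l′<l l′≢l _
  rewrite dec-true (h′ <? h) h′<h | dec-false (h′ ≟ h) h′≢h | dec-true (l′ <? l) l′<l | dec-false (l′ ≟ l) l′≢l = refl
... | tri< h′<h h′≢h _ | tri≈ _ refl _
  rewrite dec-true (h′ <? h) h′<h | dec-false (h′ ≟ h) h′≢h | dec-false (l <? l) (n≮n l) | dec-true (l ≟ l) refl = refl
... | tri< h′<h _ _    | tri> _ _ l<l′ = contradiction (l<l′ , h′<h) ¬l<l′<h′<h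
... | tri≈ _ refl _    | tri< l′<l l′≢l _
  rewrite dec-false (h <? h) (n≮n h) | dec-true (h ≟ h) refl | dec-true (l′ <? l) l′<l | dec-false (l′ ≟ l) l′≢l = refl
... | tri≈ _ refl _    | tri≈ _ refl _
  rewrite dec-false (h <? h) (n≮n h) | dec-true (h ≟ h) refl | dec-false (l <? l) (n≮n l) | dec-true (l ≟ l) refl = refl
... | tri≈ _ refl _    | tri> l′≮l l′≢l _
  rewrite dec-false (h <? h) (n≮n h) | dec-true (h ≟ h) refl | dec-false (l′ <? l) l′≮l | dec-false (l′ ≟ l) l′≢l = refl
... | tri> _ _ h<h′    | tri< l′<l _ _ = contradiction (l′<l , h<h′) ¬l′<l<h<h′
... | tri> h′≮h h′≢h _ | tri≈ _ refl _
  rewrite dec-false (h′ <? h) h′≮h | dec-false (h′ ≟ h) h′≢h | dec-false (l <? l) (n≮n l) | dec-true (l ≟ l) refl = refl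
... | tri> h′≮h h′≢h _ | tri> l′≮l l′≢l _
  rewrite dec-false (h′ <? h) h′≮h | dec-false (h′ ≟ h) h′≢h | dec-false (l′ <? l) l′≮l | dec-false (l′ ≟ l) l′≢l = refl

straddles : ℕ → ℕ → ℕ → Bool
straddles l h t = does (l <? t) ∧ not (does (h <? t))

ind-<-straddles : ∀ t {l h} → l ≤ h → ind (does (l <? t)) ≡ ind (straddles l h t) + ind (does (h <? t))
ind-<-straddles t {l} {h} l≤h with h <? t
... | yes h<t rewrite dec-true (h <? t) h<t | dec-true (l <? t) (≤-<-trans l≤h h<t) = refl
... | no  h≮t rewrite dec-false (h <? t) h≮t | ∧-identityʳ (does (l <? t)) = sym (+-identityʳ _)

ind-<-⊓⊔ : ∀ a b t → ind (does (a <? t)) + ind (does (b <? t)) ≡ ind (does (a ⊓ b <? t)) + ind (does (a ⊔ b <? t))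
ind-<-⊓⊔ a b t with ≤-total a b
... | inj₁ a≤b rewrite m≤n⇒m⊓n≡m a≤b | m≤n⇒m⊔n≡n a≤b = refl
... | inj₂ b≤a rewrite m≥n⇒m⊓n≡n b≤a | m≥n⇒m⊔n≡m b≤a = +-comm (ind (does (a <? t))) _

straddles-unit : ∀ {l h t} → h ≡ suc l → h ≢ t → straddles l h t ≡ false
straddles-unit {l} {h} {t} refl h≢t with l <? t
... | no  l≮t rewrite dec-false (l <? t) l≮t = refl
... | yes l<t rewrite dec-true (l <? t) l<t | dec-true (h <? t) (≤∧≢⇒< l<t h≢t) = refl

straddles-⊓⊔ : ∀ {w t} → w ≢ t → straddles (w ⊓ t) (w ⊔ t) t ≡ does (w <? t)
straddles-⊓⊔ {w} {t} w≢t with <-cmp w t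
... | tri< w<t _ _
  rewrite m≤n⇒m⊓n≡m (<⇒≤ w<t) | m≤n⇒m⊔n≡n (<⇒≤ w<t) | dec-true (w <? t) w<t | dec-false (t <? t) (n≮n t) = refl
... | tri≈ _ w≡t _ = contradiction w≡t w≢t
... | tri> w≮t _ t<w
  rewrite m≥n⇒m⊓n≡n (<⇒≤ t<w) | dec-false (t <? t) (n≮n t) | dec-false (w <? t) w≮t = refl

⊔-is-right : ∀ {w t} → w ≢ t → ∀ (f : ℕ → Bool) → does (w ⊔ t ≟ t) ∧ f (w ⊓ t) ≡ does (w <? t) ∧ f w
⊔-is-right {w} {t} w≢t f with <-cmp w t
... | tri< w<t _ _
  rewrite m≤n⇒m⊔n≡n (<⇒≤ w<t) | m≤n⇒m⊓n≡m (<⇒≤ w<t) | dec-true (t ≟ t) refl | dec-true (w <? t) w<t = refl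
... | tri≈ _ w≡t _ = contradiction w≡t w≢t
... | tri> w≮t _ t<w
  rewrite m≥n⇒m⊔n≡m (<⇒≤ t<w) | dec-false (w ≟ t) w≢t | dec-false (w <? t) w≮t = refl

⊓-is-right : ∀ {w t} → w ≢ t → ∀ (f : ℕ → Bool) → does (w ⊓ t ≟ t) ∧ f (w ⊔ t) ≡ not (does (w <? t)) ∧ f w
⊓-is-right {w} {t} w≢t f with <-cmp w t
... | tri< w<t _ _
  rewrite m≤n⇒m⊓n≡m (<⇒≤ w<t) | dec-false (w ≟ t) w≢t | dec-true (w <? t) w<t = refl
... | tri≈ _ w≡t _ = contradiction w≡t w≢t
... | tri> w≮t _ t<w
  rewrite m≥n⇒m⊔n≡m (<⇒≤ t<w) | m≥n⇒m⊓n≡n (<⇒≤ t<w) | dec-true (t ≟ t) refl | dec-false (w <? t) w≮t = refl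

parity-double : ∀ n → parity (n + n) ≡ 0ℙ
parity-double n = trans (+-homo-+ n n) (p+p≡0ℙ (parity n))

parity-regroup : ∀ r l c e → parity r ≡ parity (l + c) → parity (r + e) ≡ parity l +ℙ parity (c + e)
parity-regroup r l c e r≡l+c = begin
  parity (r + e)              ≡⟨ +-homo-+ r e ⟩
  parity r +ℙ parity e        ≡⟨ cong (_+ℙ parity e) r≡l+c ⟩
  parity (l + c) +ℙ parity e  ≡⟨ sym (+-homo-+ (l + c) e) ⟩
  parity (l + c + e)          ≡⟨ cong parity (+-assoc l c e) ⟩
  parity (l + (c + e))        ≡⟨ +-homo-+ l (c + e) ⟩
  parity l +ℙ parity (c + e)  ∎
  where open ≡-Reasoning

parity-+-ind-solve : ∀ π b ε → π +ℙ parity (ind b) ≡ ε → b ≡ does (π ≟ℙ ε ⁻¹) × not b ≡ does (π ≟ℙ ε)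
parity-+-ind-solve 0ℙ false .0ℙ refl = refl , refl
parity-+-ind-solve 0ℙ true  .1ℙ refl = refl , refl
parity-+-ind-solve 1ℙ false .1ℙ refl = refl , refl
parity-+-ind-solve 1ℙ true  .0ℙ refl = refl , refl

-- At a point t of a walk where a step s to w and a step o to w′ meet, ρ s - L t is congruent modulo 2 to
-- offset (long s) (w <? t) (long o) (w′ <? t) (w′ <? w); see ClosedWalk.AtCorner.ρ-at.
offset : Bool → Bool → Bool → Bool → Bool → ℕ
offset true  true  lₒ w′<t w′<w = ind (not lₒ ∧ w′<t) + ind (lₒ ∧ w′<t ∧ w′<w)
offset true  false lₒ w′<t w′<w = ind (lₒ ∧ not w′<t ∧ w′<w)
offset false true  _  _    _    = 0
offset false false lₒ w′<t _    = ind (lₒ ∧ not w′<t)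

offset-balance : ∀ lⱼ lₙ a b c → (lⱼ ≡ false → lₙ ≡ false → a ≢ b) →
                 parity (offset lⱼ a lₙ b c + ind a) ≡ parity (offset lₙ b lⱼ a (not c) + ind (not b))
offset-balance false false false false _     opposite = contradiction refl (opposite refl refl)
offset-balance false false true  true  _     opposite = contradiction refl (opposite refl refl)
offset-balance false false false true  _     _ = refl
offset-balance false false true  false _     _ = refl
offset-balance false true  false false _     _ = refl
offset-balance false true  false true  _     _ = refl
offset-balance false true  true  false _     _ = refl
offset-balance false true  true  true  _     _ = refl
offset-balance true  false false false _     _ = refl
offset-balance true  false false true  _     _ = refl
offset-balance true  false true  false _     _ = refl
offset-balance true  false true  true  _     _ = refl
offset-balance true  true  false false false _ = refl
offset-balance true  true  false false true  _ = refl
offset-balance true  true  false true  _     _ = refl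
offset-balance true  true  true  false _     _ = refl
offset-balance true  true  true  true  false _ = refl
offset-balance true  true  true  true  true  _ = refl

-- Closed walks whose short steps are unit steps

module ClosedWalk {m} (x : Fin (3 + m) → ℕ) (x-injective : Injective _≡_ _≡_ x) (long : Fin (3 + m) → Bool)
  (short-unit : ∀ i → long i ≡ false → ∣ x i - x (next i) ∣ ≤ 1)
  (long-unnested : ∀ i j → long i ≡ true → long j ≡ true →
                   ¬ (x i ⊓ x (next i) < x j ⊓ x (next j) × x j ⊔ x (next j) < x i ⊔ x (next i)))
  where

  lo hi : Fin (3 + m) → ℕ
  lo i = x i ⊓ x (next i)
  hi i = x i ⊔ x (next i)

  lo≤hi : ∀ i → lo i ≤ hi i
  lo≤hi i = m⊓n≤m⊔n (x i) (x (next i))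

  step-nondegenerate : ∀ i → x i ≢ x (next i)
  step-nondegenerate i xᵢ≡xₙᵢ = next-irreflexive (s≤s (s≤s z≤n)) i (sym (x-injective xᵢ≡xₙᵢ))

  short⇒hi≡1+lo : ∀ i → long i ≡ false → hi i ≡ suc (lo i)
  short⇒hi≡1+lo i short = ∣m-n∣≤1⇒m⊔n≡1+m⊓n (x i) (x (next i)) (step-nondegenerate i) (short-unit i short)

  no-reversed-step : ∀ {i j} → x i ≡ x (next j) → x (next i) ≡ x j → ¬ (lo i ≡ lo j)
  no-reversed-step {i} {j} xᵢ≡xₙⱼ xₙᵢ≡xⱼ _ =
    next²-irreflexive j (trans (cong next (sym (x-injective xᵢ≡xₙⱼ))) (x-injective xₙᵢ≡xⱼ))

  lo-hi-injective : ∀ {i j} → lo i ≡ lo j → hi i ≡ hi j → i ≡ j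
  lo-hi-injective {i} {j} lo≡ hi≡ with ≤-total (x i) (x (next i)) | ≤-total (x j) (x (next j))
  ... | inj₁ ↑i | inj₁ ↑j = x-injective (trans (sym (m≤n⇒m⊓n≡m ↑i)) (trans lo≡ (m≤n⇒m⊓n≡m ↑j)))
  ... | inj₂ ↓i | inj₂ ↓j = next-injective (x-injective (trans (sym (m≥n⇒m⊓n≡n ↓i)) (trans lo≡ (m≥n⇒m⊓n≡n ↓j))))
  ... | inj₁ ↑i | inj₂ ↓j = contradiction lo≡ (no-reversed-step
    (trans (sym (m≤n⇒m⊓n≡m ↑i)) (trans lo≡ (m≥n⇒m⊓n≡n ↓j)))
    (trans (sym (m≤n⇒m⊔n≡n ↑i)) (trans hi≡ (m≥n⇒m⊔n≡m ↓j))))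
  ... | inj₂ ↓i | inj₁ ↑j = contradiction lo≡ (no-reversed-step
    (trans (sym (m≥n⇒m⊔n≡m ↓i)) (trans hi≡ (m≤n⇒m⊔n≡n ↑j)))
    (trans (sym (m≥n⇒m⊓n≡n ↓i)) (trans lo≡ (m≤n⇒m⊓n≡m ↑j))))

  ascending descending : Fin (3 + m) → Bool
  ascending  i = does (x i <? x (next i))
  descending i = does (x (next i) <? x i)

  L R : ℕ → ℕ
  L t = count (λ i → long i ∧ does (lo i <? t))
  R t = count (λ i → long i ∧ does (hi i <? t))

  crossings : ℕ → ℕ
  crossings t = count (λ i → straddles (lo i) (hi i) t)

  shortCrossings : ℕ → ℕ
  shortCrossings t = count (λ i → not (long i) ∧ straddles (lo i) (hi i) t)

  crossings-even : ∀ t → parity (crossings t) ≡ 0ℙ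
  crossings-even t = begin
    parity (crossings t)                       ≡⟨ sym (+ℙ-identityʳ _) ⟩
    parity (crossings t) +ℙ 0ℙ                 ≡⟨ cong (parity (crossings t) +ℙ_) (sym (parity-double H)) ⟩
    parity (crossings t) +ℙ parity (H + H)     ≡⟨ sym (+-homo-+ (crossings t) (H + H)) ⟩
    parity (crossings t + (H + H))             ≡⟨ cong parity (sym ends-below) ⟩
    parity (X + X)                             ≡⟨ parity-double X ⟩
    0ℙ                                         ∎
    where
    open ≡-Reasoning
    below-t : ℕ → Bool
    below-t n = does (n <? t)
    X H : ℕ
    X = count (below-t ∘ x)
    H = count (below-t ∘ hi)
    ends : ∀ i → ind (below-t (x i)) + ind (below-t (x (next i))) ≡
                 ind (straddles (lo i) (hi i) t) + (ind (below-t (hi i)) + ind (below-t (hi i)))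
    ends i = trans (ind-<-⊓⊔ (x i) (x (next i)) t)
                   (trans (cong (_+ ind (below-t (hi i))) (ind-<-straddles t (lo≤hi i)))
                          (+-assoc (ind (straddles (lo i) (hi i) t)) _ _))
    ends-below : X + X ≡ crossings t + (H + H)
    ends-below = begin
      X + X
        ≡⟨ cong (X +_) (sym (count-rotate (below-t ∘ x))) ⟩
      X + count (below-t ∘ x ∘ next)
        ≡⟨ sym (∑-distrib-+ (ind ∘ below-t ∘ x) (ind ∘ below-t ∘ x ∘ next)) ⟩
      sum (λ i → ind (below-t (x i)) + ind (below-t (x (next i))))
        ≡⟨ sum-cong-≗ ends ⟩
      sum (λ i → ind (straddles (lo i) (hi i) t) + (ind (below-t (hi i)) + ind (below-t (hi i))))
        ≡⟨ ∑-distrib-+ (λ i → ind (straddles (lo i) (hi i) t)) (λ i → ind (below-t (hi i)) + ind (below-t (hi i))) ⟩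
      crossings t + sum (λ i → ind (below-t (hi i)) + ind (below-t (hi i)))
        ≡⟨ cong (crossings t +_) (∑-distrib-+ (ind ∘ below-t ∘ hi) (ind ∘ below-t ∘ hi)) ⟩
      crossings t + (H + H)
        ∎

  L-parity : ∀ t → parity (L t + shortCrossings t) ≡ parity (R t)
  L-parity t = begin
    parity (L t + S)                       ≡⟨ cong (λ n → parity (n + S)) L≡LC+R ⟩
    parity (LC + R t + S)                  ≡⟨ cong parity (trans (cong (_+ S) (+-comm LC (R t)))
                                                                 (+-assoc (R t) LC S)) ⟩
    parity (R t + (LC + S))                ≡⟨ cong (λ n → parity (R t + n)) (sym crossings≡LC+S) ⟩
    parity (R t + crossings t)             ≡⟨ +-homo-+ (R t) (crossings t) ⟩
    parity (R t) +ℙ parity (crossings t)   ≡⟨ cong (parity (R t) +ℙ_) (crossings-even t) ⟩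
    parity (R t) +ℙ 0ℙ                     ≡⟨ +ℙ-identityʳ (parity (R t)) ⟩
    parity (R t)                           ∎
    where
    open ≡-Reasoning
    longCrossing : Fin (3 + m) → Bool
    longCrossing i = long i ∧ straddles (lo i) (hi i) t
    LC : ℕ
    LC = count longCrossing
    L≡LC+R : L t ≡ LC + R t
    L≡LC+R = count-split _ longCrossing (λ i → long i ∧ does (hi i <? t))
                         (λ i → ∧-ind-split (long i) (ind-<-straddles t (lo≤hi i)))
    S : ℕ
    S = shortCrossings t
    crossings≡LC+S : crossings t ≡ LC + S
    crossings≡LC+S = count-split _ longCrossing _ (λ i → ind-split-by (long i) _)

  L-suc : ∀ t → L (suc t) ≡ L t + count (λ i → long i ∧ does (lo i ≟ t))
  L-suc t = count-split _ (λ i → long i ∧ does (lo i <? t)) (λ i → long i ∧ does (lo i ≟ t))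
                          (λ i → ∧-ind-split (long i) (ind-<-suc (lo i) t))

  -- orders the steps lexicographically by (hi, lo), see square-pairing-<
  key : Fin (3 + m) → ℕ
  key i = hi i * hi i + lo i

  key-injective : ∀ {i j} → long i ≡ true → long j ≡ true → key i ≡ key j → i ≡ j
  key-injective {i} {j} _ _ kᵢ≡kⱼ with hi≡ , lo≡ ← square-pairing-injective (lo≤hi i) (lo≤hi j) kᵢ≡kⱼ =
    lo-hi-injective lo≡ hi≡

  open RankParity long key key-injective using (rank; ofParity; withRankParity; rank-parities-balanced)

  rank-via-hi : ∀ i {h l} → hi i ≡ h → lo i ≡ l →
                rank i ≡ R h + count (λ j → long j ∧ does (hi j ≟ h) ∧ does (lo j <? l))
  rank-via-hi i refl refl =
    count-split _ (λ j → long j ∧ does (hi j <? hi i)) (λ j → long j ∧ does (hi j ≟ hi i) ∧ does (lo j <? lo i))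
                (λ j → ∧-ind-split (long j) (square-pairing-< (lo≤hi i) (lo≤hi j)))

  rank-via-lo : ∀ i {h l} → long i ≡ true → hi i ≡ h → lo i ≡ l →
                rank i ≡ L l + count (λ j → long j ∧ does (lo j ≟ l) ∧ does (hi j <? h))
  rank-via-lo i long-i refl refl =
    count-split _ (λ j → long j ∧ does (lo j <? lo i)) (λ j → long j ∧ does (lo j ≟ lo i) ∧ does (hi j <? hi i)) lex
    where
    lex : ∀ j → ind (long j ∧ does (key j <? key i)) ≡
                ind (long j ∧ does (lo j <? lo i)) + ind (long j ∧ does (lo j ≟ lo i) ∧ does (hi j <? hi i))
    lex j with long j in long-j
    ... | false = refl
    ... | true  = trans (square-pairing-< (lo≤hi i) (lo≤hi j))
                        (unnested-lex-swap (long-unnested j i long-j long-i) (long-unnested i j long-i long-j))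

  ρ : Fin (3 + m) → ℕ
  ρ i = if long i then rank i else L (hi i)

  record Corner (t : ℕ) (s o : Fin (3 + m)) (w w′ : ℕ) : Set where
    field
      s≢o       : s ≢ o
      elsewhere : ∀ i → i ≢ s → i ≢ o → lo i ≢ t × hi i ≢ t
      lo-s      : lo s ≡ w ⊓ t
      hi-s      : hi s ≡ w ⊔ t
      lo-o      : lo o ≡ w′ ⊓ t
      hi-o      : hi o ≡ w′ ⊔ t
      w≢t       : w ≢ t
      w′≢t      : w′ ≢ t

  corner : ∀ j → Corner (x (next j)) j (next j) (x j) (x (next (next j)))
  corner j = record
    { s≢o       = next-irreflexive (s≤s (s≤s z≤n)) j ∘ sym
    ; elsewhere = λ i i≢j i≢nj → ends-elsewhere (i≢nj ∘ x-injective) (i≢j ∘ next-injective ∘ x-injective)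
    ; lo-s      = refl
    ; hi-s      = refl
    ; lo-o      = ⊓-comm (x (next j)) _
    ; hi-o      = ⊔-comm (x (next j)) _
    ; w≢t       = step-nondegenerate j
    ; w′≢t      = step-nondegenerate (next j) ∘ sym
    }
    where
    ends-elsewhere : ∀ {a b t} → a ≢ t → b ≢ t → a ⊓ b ≢ t × a ⊔ b ≢ t
    ends-elsewhere {a} {b} a≢t b≢t = [ (λ eq → a≢t ∘ trans (sym eq)) , (λ eq → b≢t ∘ trans (sym eq)) ]′ (⊓-sel a b)
                                   , [ (λ eq → a≢t ∘ trans (sym eq)) , (λ eq → b≢t ∘ trans (sym eq)) ]′ (⊔-sel a b)

  Corner-swap : ∀ {t s o w w′} → Corner t s o w w′ → Corner t o s w′ w
  Corner-swap c = record
    { s≢o  = s≢o ∘ sym ; elsewhere = λ i i≢o i≢s → elsewhere i i≢s i≢o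
    ; lo-s = lo-o ; hi-s = hi-o ; lo-o = lo-s ; hi-o = hi-s ; w≢t = w′≢t ; w′≢t = w≢t }
    where open Corner c

  module AtCorner {t s o w w′} (c : Corner t s o w w′) where
    open Corner c

    count-at : (p : Fin (3 + m) → Bool) → (∀ i → lo i ≢ t → hi i ≢ t → p i ≡ false) → count p ≡ ind (p s) + ind (p o)
    count-at p vanish = count-pair p s≢o (λ i i≢s i≢o → uncurry (vanish i) (elsewhere i i≢s i≢o))

    upper-end : w < t → lo s ≡ w × hi s ≡ t
    upper-end w<t = trans lo-s (m≤n⇒m⊓n≡m (<⇒≤ w<t)) , trans hi-s (m≤n⇒m⊔n≡n (<⇒≤ w<t))

    lower-end : t < w → lo s ≡ t × hi s ≡ w
    lower-end t<w = trans lo-s (m≥n⇒m⊓n≡n (<⇒≤ t<w)) , trans hi-s (m≥n⇒m⊔n≡m (<⇒≤ t<w))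

    w′<ᵇt w′<ᵇw : Bool
    w′<ᵇt = does (w′ <? t)
    w′<ᵇw = does (w′ <? w)

    shortCrossings-at : long s ≡ true → shortCrossings t ≡ ind (not (long o) ∧ w′<ᵇt)
    shortCrossings-at long-s = begin
      shortCrossings t
        ≡⟨ count-at _ vanish ⟩
      ind (not (long s) ∧ straddles (lo s) (hi s) t) + ind (not (long o) ∧ straddles (lo o) (hi o) t)
        ≡⟨ cong₂ (λ a b → ind (not a ∧ straddles (lo s) (hi s) t) + ind (not (long o) ∧ b))
                 long-s (cong₂ (λ l h → straddles l h t) lo-o hi-o) ⟩
      ind (not (long o) ∧ straddles (w′ ⊓ t) (w′ ⊔ t) t)
        ≡⟨ cong (λ b → ind (not (long o) ∧ b)) (straddles-⊓⊔ w′≢t) ⟩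
      ind (not (long o) ∧ w′<ᵇt)
        ∎
      where
      open ≡-Reasoning
      vanish : ∀ i → lo i ≢ t → hi i ≢ t → not (long i) ∧ straddles (lo i) (hi i) t ≡ false
      vanish i _ hᵢ≢t with long i in long-i
      ... | true  = refl
      ... | false = straddles-unit (short⇒hi≡1+lo i long-i) hᵢ≢t

    ties-upper : w < t → count (λ j → long j ∧ does (hi j ≟ t) ∧ does (lo j <? w)) ≡ ind (long o ∧ w′<ᵇt ∧ w′<ᵇw)
    ties-upper w<t = begin
      count (λ j → long j ∧ does (hi j ≟ t) ∧ does (lo j <? w))
        ≡⟨ count-at _ (λ j _ hⱼ≢t → ∧-≟-miss (long j) _ hⱼ≢t) ⟩
      ind (long s ∧ does (hi s ≟ t) ∧ does (lo s <? w)) + ind (long o ∧ does (hi o ≟ t) ∧ does (lo o <? w))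
        ≡⟨ cong₂ _+_ (cong ind s-misses) (cong₂ (λ l h → ind (long o ∧ does (h ≟ t) ∧ does (l <? w))) lo-o hi-o) ⟩
      ind (long o ∧ does (w′ ⊔ t ≟ t) ∧ does (w′ ⊓ t <? w))
        ≡⟨ cong (λ b → ind (long o ∧ b)) (⊔-is-right w′≢t (λ l → does (l <? w))) ⟩
      ind (long o ∧ w′<ᵇt ∧ w′<ᵇw)
        ∎
      where
      open ≡-Reasoning
      s-misses : long s ∧ does (hi s ≟ t) ∧ does (lo s <? w) ≡ false
      s-misses = trans (cong (λ l → long s ∧ does (hi s ≟ t) ∧ does (l <? w)) (proj₁ (upper-end w<t)))
                       (∧-<-irrefl (long s) _ w)

    ties-lower : t < w → count (λ j → long j ∧ does (lo j ≟ t) ∧ does (hi j <? w)) ≡ ind (long o ∧ not w′<ᵇt ∧ w′<ᵇw)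
    ties-lower t<w = begin
      count (λ j → long j ∧ does (lo j ≟ t) ∧ does (hi j <? w))
        ≡⟨ count-at _ (λ j lⱼ≢t _ → ∧-≟-miss (long j) _ lⱼ≢t) ⟩
      ind (long s ∧ does (lo s ≟ t) ∧ does (hi s <? w)) + ind (long o ∧ does (lo o ≟ t) ∧ does (hi o <? w))
        ≡⟨ cong₂ _+_ (cong ind s-misses) (cong₂ (λ l h → ind (long o ∧ does (l ≟ t) ∧ does (h <? w))) lo-o hi-o) ⟩
      ind (long o ∧ does (w′ ⊓ t ≟ t) ∧ does (w′ ⊔ t <? w))
        ≡⟨ cong (λ b → ind (long o ∧ b)) (⊓-is-right w′≢t (λ h → does (h <? w))) ⟩
      ind (long o ∧ not w′<ᵇt ∧ w′<ᵇw)
        ∎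
      where
      open ≡-Reasoning
      s-misses : long s ∧ does (lo s ≟ t) ∧ does (hi s <? w) ≡ false
      s-misses = trans (cong (λ h → long s ∧ does (lo s ≟ t) ∧ does (h <? w)) (proj₂ (lower-end t<w)))
                       (∧-<-irrefl (long s) _ w)

    ρ-long-upper : long s ≡ true → w < t →
                   parity (rank s) ≡ parity (L t + (ind (not (long o) ∧ w′<ᵇt) + ind (long o ∧ w′<ᵇt ∧ w′<ᵇw)))
    ρ-long-upper long-s w<t = begin
      parity (rank s)
        ≡⟨ cong parity (rank-via-hi s (proj₂ (upper-end w<t)) (proj₁ (upper-end w<t))) ⟩
      parity (R t + ties)
        ≡⟨ parity-regroup (R t) (L t) (shortCrossings t) ties (sym (L-parity t)) ⟩
      parity (L t) +ℙ parity (shortCrossings t + ties)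
        ≡⟨ cong₂ (λ a b → parity (L t) +ℙ parity (a + b)) (shortCrossings-at long-s) (ties-upper w<t) ⟩
      parity (L t) +ℙ parity (ind (not (long o) ∧ w′<ᵇt) + ind (long o ∧ w′<ᵇt ∧ w′<ᵇw))
        ≡⟨ sym (+-homo-+ (L t) _) ⟩
      parity (L t + (ind (not (long o) ∧ w′<ᵇt) + ind (long o ∧ w′<ᵇt ∧ w′<ᵇw)))
        ∎
      where
      open ≡-Reasoning
      ties : ℕ
      ties = count (λ j → long j ∧ does (hi j ≟ t) ∧ does (lo j <? w))

    ρ-long-lower : long s ≡ true → t < w → rank s ≡ L t + ind (long o ∧ not w′<ᵇt ∧ w′<ᵇw)
    ρ-long-lower long-s t<w =
      trans (rank-via-lo s long-s (proj₂ (lower-end t<w)) (proj₁ (lower-end t<w))) (cong (L t +_) (ties-lower t<w))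

    ρ-short-upper : w < t → L (hi s) ≡ L t
    ρ-short-upper w<t = cong L (proj₂ (upper-end w<t))

    ρ-short-lower : long s ≡ false → t < w → L (hi s) ≡ L t + ind (long o ∧ not w′<ᵇt)
    ρ-short-lower long-s t<w = begin
      L (hi s)
        ≡⟨ cong L (trans (short⇒hi≡1+lo s long-s) (cong suc (proj₁ (lower-end t<w)))) ⟩
      L (suc t)
        ≡⟨ L-suc t ⟩
      L t + count (λ i → long i ∧ does (lo i ≟ t))
        ≡⟨ cong (L t +_) (count-at _ (λ i lᵢ≢t _ → trans (cong (long i ∧_) (dec-false (lo i ≟ t) lᵢ≢t))
                                                         (∧-zeroʳ (long i)))) ⟩
      L t + (ind (long s ∧ does (lo s ≟ t)) + ind (long o ∧ does (lo o ≟ t)))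
        ≡⟨ cong₂ (λ a l → L t + (ind (a ∧ does (lo s ≟ t)) + ind (long o ∧ does (l ≟ t)))) long-s lo-o ⟩
      L t + ind (long o ∧ does (w′ ⊓ t ≟ t))
        ≡⟨ cong (λ b → L t + ind (long o ∧ b)) lo-o-at-t ⟩
      L t + ind (long o ∧ not w′<ᵇt)
        ∎
      where
      open ≡-Reasoning
      lo-o-at-t : does (w′ ⊓ t ≟ t) ≡ not w′<ᵇt
      lo-o-at-t = trans (sym (∧-identityʳ _)) (trans (⊓-is-right w′≢t (λ _ → true)) (∧-identityʳ _))

    ρ-at : parity (ρ s) ≡ parity (L t + offset (long s) (does (w <? t)) (long o) (does (w′ <? t)) (does (w′ <? w)))
    ρ-at with long s in long-s | <-cmp w t
    ... | true  | tri< w<t _ _   rewrite dec-true  (w <? t) w<t = ρ-long-upper long-s w<t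
    ... | true  | tri> w≮t _ t<w rewrite dec-false (w <? t) w≮t = cong parity (ρ-long-lower long-s t<w)
    ... | false | tri< w<t _ _   rewrite dec-true  (w <? t) w<t =
      cong parity (trans (ρ-short-upper w<t) (sym (+-identityʳ _)))
    ... | false | tri> w≮t _ t<w rewrite dec-false (w <? t) w≮t = cong parity (ρ-short-lower long-s t<w)
    ... | _     | tri≈ _ w≡t _   = contradiction w≡t w≢t

  short-steps-opposite : ∀ {t s o w w′} → Corner t s o w w′ → long s ≡ false → long o ≡ false →
                         does (w <? t) ≢ does (w′ <? t)
  short-steps-opposite {t} {s} {o} {w} {w′} c short-s short-o same-side with <-cmp w t | <-cmp w′ t
  ... | tri< w<t _ _ | tri< w′<t _ _ = Corner.s≢o c (lo-hi-injective lₛ≡lₒ hₛ≡hₒ)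
    where
    hₛ≡hₒ : hi s ≡ hi o
    hₛ≡hₒ = trans (proj₂ (AtCorner.upper-end c w<t)) (sym (proj₂ (AtCorner.upper-end (Corner-swap c) w′<t)))
    lₛ≡lₒ : lo s ≡ lo o
    lₛ≡lₒ = suc-injective (trans (sym (short⇒hi≡1+lo s short-s)) (trans hₛ≡hₒ (short⇒hi≡1+lo o short-o)))
  ... | tri> _ _ t<w | tri> _ _ t<w′ = Corner.s≢o c (lo-hi-injective lₛ≡lₒ hₛ≡hₒ)
    where
    lₛ≡lₒ : lo s ≡ lo o
    lₛ≡lₒ = trans (proj₁ (AtCorner.lower-end c t<w)) (sym (proj₁ (AtCorner.lower-end (Corner-swap c) t<w′)))
    hₛ≡hₒ : hi s ≡ hi o
    hₛ≡hₒ = trans (short⇒hi≡1+lo s short-s) (trans (cong suc lₛ≡lₒ) (sym (short⇒hi≡1+lo o short-o)))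
  ... | tri< w<t _ _ | tri> w′≮t _ _
    with () ← trans (sym (dec-true (w <? t) w<t)) (trans same-side (dec-false (w′ <? t) w′≮t))
  ... | tri> w≮t _ _ | tri< w′<t _ _
    with () ← trans (sym (dec-false (w <? t) w≮t)) (trans same-side (dec-true (w′ <? t) w′<t))
  ... | tri≈ _ w≡t _ | _             = Corner.w≢t c w≡t
  ... | _            | tri≈ _ w′≡t _ = Corner.w′≢t c w′≡t

  Φ : Fin (3 + m) → Parity
  Φ i = parity (ρ i + ind (ascending i))

  Φ-next : ∀ j → Φ (next j) ≡ Φ j
  Φ-next j = begin
    parity (ρ (next j) + ind (does (t <? v)))
      ≡⟨ cong (λ b → parity (ρ (next j) + ind b)) (<?-flip (Corner.w′≢t c)) ⟩
    parity (ρ (next j) + ind (not b))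
      ≡⟨ parity-regroup (ρ (next j)) (L t) _ (ind (not b)) (AtCorner.ρ-at (Corner-swap c)) ⟩
    parity (L t) +ℙ parity (offset (long (next j)) b (long j) a (does (u <? v)) + ind (not b))
      ≡⟨ cong (λ z → parity (L t) +ℙ parity (offset (long (next j)) b (long j) a z + ind (not b))) (<?-flip v≢u) ⟩
    parity (L t) +ℙ parity (offset (long (next j)) b (long j) a (not c′) + ind (not b))
      ≡⟨ cong (parity (L t) +ℙ_) (sym (offset-balance (long j) (long (next j)) a b c′ (short-steps-opposite c))) ⟩
    parity (L t) +ℙ parity (offset (long j) a (long (next j)) b c′ + ind a)
      ≡⟨ sym (parity-regroup (ρ j) (L t) _ (ind a) (AtCorner.ρ-at c)) ⟩
    parity (ρ j + ind a)
      ∎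
    where
    open ≡-Reasoning
    c = corner j
    t u v : ℕ
    t = x (next j)
    u = x j
    v = x (next (next j))
    a b c′ : Bool
    a  = does (u <? t)
    b  = does (v <? t)
    c′ = does (v <? u)
    v≢u : v ≢ u
    v≢u = next²-irreflexive j ∘ x-injective

  Φ-constant : ∀ i → Φ i ≡ Φ zero
  Φ-constant = next-induction (λ i → Φ i ≡ Φ zero) refl (λ i Φᵢ≡Φ₀ → trans (Φ-next i) Φᵢ≡Φ₀)

  direction-by-rank : ∀ i → long i ≡ true →
                      ascending  i ≡ does (parity (rank i) ≟ℙ Φ zero ⁻¹) ×
                      descending i ≡ does (parity (rank i) ≟ℙ Φ zero)
  direction-by-rank i long-i = proj₁ solved , trans (<?-flip (step-nondegenerate i)) (proj₂ solved)
    where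
    Φᵢ : parity (rank i) +ℙ parity (ind (ascending i)) ≡ Φ zero
    Φᵢ = trans (sym (+-homo-+ (rank i) _))
               (subst (λ l → parity ((if l then rank i else L (hi i)) + ind (ascending i)) ≡ Φ zero)
                      long-i (Φ-constant i))
    solved = parity-+-ind-solve (parity (rank i)) (ascending i) (Φ zero) Φᵢ

  long-steps-balanced : ∣ count (λ i → long i ∧ ascending i) - count (λ i → long i ∧ descending i) ∣ ≤ 1
  long-steps-balanced =
    subst₂ (λ a d → ∣ a - d ∣ ≤ 1) (sym (count-cong ascents)) (sym (count-cong descents)) (either (Φ zero))
    where
    ascents : ∀ i → long i ∧ ascending i ≡ ofParity (Φ zero ⁻¹) i
    ascents i with long i in long-i
    ... | false = refl
    ... | true  = proj₁ (direction-by-rank i long-i)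
    descents : ∀ i → long i ∧ descending i ≡ ofParity (Φ zero) i
    descents i with long i in long-i
    ... | false = refl
    ... | true  = proj₂ (direction-by-rank i long-i)
    either : ∀ π → ∣ withRankParity (π ⁻¹) - withRankParity π ∣ ≤ 1
    either 0ℙ = subst (_≤ 1) (∣-∣-comm (withRankParity 0ℙ) _) rank-parities-balanced
    either 1ℙ = rank-parities-balanced

-- the two counts of closed-walk-balanced for the walk x₀ → x₁ → x₀
two-step-balanced : ∀ l₀ l₁ a → ∣ ind (l₀ ∧ a) + (ind (l₁ ∧ not a) + 0) - ind (l₀ ∧ not a) + (ind (l₁ ∧ a) + 0) ∣ ≤ 1
two-step-balanced false false _     = z≤n
two-step-balanced false true  false = s≤s z≤n
two-step-balanced false true  true  = s≤s z≤n
two-step-balanced true  false false = s≤s z≤n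
two-step-balanced true  false true  = s≤s z≤n
two-step-balanced true  true  false = z≤n
two-step-balanced true  true  true  = z≤n

closed-walk-balanced : ∀ {k} → 2 ≤ k → (x : Fin k → ℕ) → Injective _≡_ _≡_ x → (long : Fin k → Bool) →
  (∀ i → long i ≡ false → ∣ x i - x (next i) ∣ ≤ 1) →
  (∀ i j → long i ≡ true → long j ≡ true →
     ¬ (x i ⊓ x (next i) < x j ⊓ x (next j) × x j ⊔ x (next j) < x i ⊔ x (next i))) →
  ∣ count (λ i → long i ∧ does (x i <? x (next i))) - count (λ i → long i ∧ does (x (next i) <? x i)) ∣ ≤ 1
closed-walk-balanced {1} (s≤s ())
closed-walk-balanced {2} _ x x-injective long _ _
  rewrite <?-flip {x zero} {x (suc zero)} (Finₚ.0≢1+n ∘ x-injective) =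
  two-step-balanced (long zero) (long (suc zero)) _
closed-walk-balanced {suc (suc (suc m))} _ = ClosedWalk.long-steps-balanced

-- Cycles of M_A △ M_B

length-filter-tabulate : ∀ {a p} {X : Set a} {P : X → Set p} (P? : Decidable P) {m} (f : Fin m → X) →
                         length (filter P? (tabulate f)) ≡ count (λ i → does (P? (f i)))
length-filter-tabulate P? {zero}  f = refl
length-filter-tabulate P? {suc m} f with does (P? (f zero))
... | true  = cong suc (length-filter-tabulate P? (f ∘ suc))
... | false = length-filter-tabulate P? (f ∘ suc)

∣-∣-transfer : ∀ {a b c d} → a + d ≡ b + c → ∣ a - b ∣ ≡ ∣ c - d ∣
∣-∣-transfer {a} {b} {c} {d} a+d≡b+c = begin
  ∣ a - b ∣          ≡⟨ sym (∣m+n-m+o∣≡∣n-o∣ d a b) ⟩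
  ∣ d + a - d + b ∣  ≡⟨ cong₂ ∣_-_∣ (trans (+-comm d a) a+d≡b+c) (+-comm d b) ⟩
  ∣ b + c - b + d ∣  ≡⟨ ∣m+n-m+o∣≡∣n-o∣ b c d ⟩
  ∣ c - d ∣          ∎
  where open ≡-Reasoning

module _ {n} {v : Fin n} {A B : Subset n} where

  xor-true⇒∈△ : (v∈?A : Dec (v ∈ A)) (v∈?B : Dec (v ∈ B)) → does v∈?A xor does v∈?B ≡ true → v ∈△ (A , B)
  xor-true⇒∈△ (yes v∈A) (no  v∉B) _ = inj₁ (v∈A , v∉B)
  xor-true⇒∈△ (no  v∉A) (yes v∈B) _ = inj₂ (v∈B , v∉A)

  xor-false⇒∉△ : (v∈?A : Dec (v ∈ A)) (v∈?B : Dec (v ∈ B)) → does v∈?A xor does v∈?B ≡ false → ¬ v ∈△ (A , B)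
  xor-false⇒∉△ (yes v∈A) (yes v∈B) _ = [ (λ (_ , v∉B) → v∉B v∈B) , (λ (_ , v∉A) → v∉A v∈A) ]′
  xor-false⇒∉△ (no  v∉A) (no  v∉B) _ = [ (λ (v∈A , _) → v∉A v∈A) , (λ (v∈B , _) → v∉B v∈B) ]′

  membership-by-direction : (v∈?A : Dec (v ∈ A)) (v∈?B : Dec (v ∈ B)) (a b : ℕ) →
    (v ∈ A → v ∉ B → a < b) → (v ∈ B → v ∉ A → b < a) →
    ind (does v∈?A) + ind ((does v∈?A xor does v∈?B) ∧ does (b <? a)) ≡
    ind (does v∈?B) + ind ((does v∈?A xor does v∈?B) ∧ does (a <? b))
  membership-by-direction (yes _)   (yes _)   a b _ _ = refl
  membership-by-direction (no  _)   (no  _)   a b _ _ = refl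
  membership-by-direction (yes v∈A) (no  v∉B) a b A⇒a<b _
    rewrite dec-false (b <? a) (<⇒≯ (A⇒a<b v∈A v∉B)) | dec-true (a <? b) (A⇒a<b v∈A v∉B) = refl
  membership-by-direction (no  v∉A) (yes v∈B) a b _ B⇒b<a
    rewrite dec-true (b <? a) (B⇒b<a v∈B v∉A) | dec-false (a <? b) (<⇒≯ (B⇒b<a v∈B v∉A)) = refl

module SymmetricDifferenceCycle {n} (A B : Subset n) {MA MB : Fin n → Fin n}
  (MA-injective : Injective _≡_ _≡_ MA) (MB-injective : Injective _≡_ _≡_ MB) (C : Cycle (InSymDiffEdge MA MB)) where
  open Cycle C

  -- the cycle runs vⱼ —Q— wⱼ —P— vⱼ₊₁
  Traversed : (P Q : Fin n → Fin n) → Fin k → Set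
  Traversed P Q j = Q (vs j) ≡ ws j × P (vs (next j)) ≡ ws j

  matched-by : ∀ {v w} → InSymDiffEdge MA MB v w → MA v ≡ w ⊎ MB v ≡ w
  matched-by = Sum.map proj₁ proj₁

  MA≢MB : ∀ i → MA (vs i) ≢ MB (vs i)
  MA≢MB i MAᵢ≡MBᵢ with edge₁ i
  ... | inj₁ (MAᵢ≡wᵢ , MBᵢ≢wᵢ) = MBᵢ≢wᵢ (trans (sym MAᵢ≡MBᵢ) MAᵢ≡wᵢ)
  ... | inj₂ (MBᵢ≡wᵢ , MAᵢ≢wᵢ) = MAᵢ≢wᵢ (trans MAᵢ≡MBᵢ MBᵢ≡wᵢ)

  traversal-at : ∀ j → Traversed MA MB j ⊎ Traversed MB MA j
  traversal-at j with matched-by (edge₁ j) | matched-by (edge₂ j)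
  ... | inj₁ MAⱼ≡wⱼ | inj₂ MBₙⱼ≡wⱼ = inj₂ (MAⱼ≡wⱼ , MBₙⱼ≡wⱼ)
  ... | inj₂ MBⱼ≡wⱼ | inj₁ MAₙⱼ≡wⱼ = inj₁ (MBⱼ≡wⱼ , MAₙⱼ≡wⱼ)
  ... | inj₁ MAⱼ≡wⱼ | inj₁ MAₙⱼ≡wⱼ =
    contradiction (vs-inj (MA-injective (trans MAₙⱼ≡wⱼ (sym MAⱼ≡wⱼ)))) (next-irreflexive k≥2 j)
  ... | inj₂ MBⱼ≡wⱼ | inj₂ MBₙⱼ≡wⱼ =
    contradiction (vs-inj (MB-injective (trans MBₙⱼ≡wⱼ (sym MBⱼ≡wⱼ)))) (next-irreflexive k≥2 j)

  traversal-step : ∀ {P Q} → (∀ j → Traversed P Q j ⊎ Traversed Q P j) →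
                   ∀ j → Traversed P Q j → Traversed P Q (next j)
  traversal-step traversal j (_ , Pₙⱼ≡wⱼ) with traversal (next j)
  ... | inj₁ forward       = forward
  ... | inj₂ (Pₙⱼ≡wₙⱼ , _) = contradiction (ws-inj (trans (sym Pₙⱼ≡wⱼ) Pₙⱼ≡wₙⱼ)) (next-irreflexive k≥2 j ∘ sym)

  orientation : (∀ j → Traversed MA MB j) ⊎ (∀ j → Traversed MB MA j)
  orientation = next-invariant-choice _ _ traversal-at (traversal-step {MA} {MB} traversal-at)
                                                       (traversal-step {MB} {MA} (Sum.swap ∘ traversal-at))

  oriented-directions-balanced : (long : Fin k → Bool) → ∀ {P Q} → Injective _≡_ _≡_ P → (∀ j → Traversed P Q j) →
    (∀ i → long i ≡ false → ∣ toℕ (P (vs i)) - toℕ (Q (vs i)) ∣ ≤ 1) →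
    (∀ i j → long i ≡ true → long j ≡ true →
       ¬ (toℕ (P (vs i)) ⊓ toℕ (Q (vs i)) < toℕ (P (vs j)) ⊓ toℕ (Q (vs j)) ×
          toℕ (P (vs j)) ⊔ toℕ (Q (vs j)) < toℕ (P (vs i)) ⊔ toℕ (Q (vs i)))) →
    ∣ count (λ i → long i ∧ does (toℕ (P (vs i)) <? toℕ (Q (vs i)))) -
      count (λ i → long i ∧ does (toℕ (Q (vs i)) <? toℕ (P (vs i)))) ∣ ≤ 1
  oriented-directions-balanced long {P} {Q} P-injective traversed short-unit long-unnested =
    subst₂ (λ a d → ∣ a - d ∣ ≤ 1) (count-cong (λ i → cong (λ y → long i ∧ does (x i <? y)) (x-next i)))
                                   (count-cong (λ i → cong (λ y → long i ∧ does (y <? x i)) (x-next i)))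
           (closed-walk-balanced k≥2 x (vs-inj ∘ P-injective ∘ toℕ-injective) long short-unit′ long-unnested′)
    where
    x : Fin k → ℕ
    x i = toℕ (P (vs i))
    x-next : ∀ i → x (next i) ≡ toℕ (Q (vs i))
    x-next i = cong toℕ (trans (proj₂ (traversed i)) (sym (proj₁ (traversed i))))
    short-unit′ : ∀ i → long i ≡ false → ∣ x i - x (next i) ∣ ≤ 1
    short-unit′ i rewrite x-next i = short-unit i
    long-unnested′ : ∀ i j → long i ≡ true → long j ≡ true →
                     ¬ (x i ⊓ x (next i) < x j ⊓ x (next j) × x j ⊔ x (next j) < x i ⊔ x (next i))
    long-unnested′ i j rewrite x-next i | x-next j = long-unnested i j

  ma mb : Fin k → ℕ
  ma i = toℕ (MA (vs i))
  mb i = toℕ (MB (vs i))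

  long : Fin k → Bool
  long i = does (vs i ∈? A) xor does (vs i ∈? B)

  ascents descents : ℕ
  ascents  = count (λ i → long i ∧ does (ma i <? mb i))
  descents = count (λ i → long i ∧ does (mb i <? ma i))

  countIn-difference : (∀ v → v ∈ A → v ∉ B → toℕ (MA v) ≤ toℕ (MB v)) →
                       (∀ v → v ∈ B → v ∉ A → toℕ (MB v) ≤ toℕ (MA v)) →
                       ∣ countIn A C - countIn B C ∣ ≡ ∣ ascents - descents ∣
  countIn-difference up-in-A down-in-B = ∣-∣-transfer {countIn A C} {countIn B C} {ascents} {descents} (begin
    countIn A C + descents                     ≡⟨ cong (_+ descents) (length-filter-tabulate (λ i → vs i ∈? A) id) ⟩
    count (λ i → does (vs i ∈? A)) + descents  ≡⟨ count-+-cong _ _ _ _ (λ i →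
                                                    membership-by-direction (vs i ∈? A) (vs i ∈? B) (ma i) (mb i)
                                                                            (A⇒ma<mb i) (B⇒mb<ma i)) ⟩
    count (λ i → does (vs i ∈? B)) + ascents   ≡⟨ cong (_+ ascents)
                                                       (sym (length-filter-tabulate (λ i → vs i ∈? B) id)) ⟩
    countIn B C + ascents                      ∎)
    where
    open ≡-Reasoning
    A⇒ma<mb : ∀ i → vs i ∈ A → vs i ∉ B → ma i < mb i
    A⇒ma<mb i ∈A ∉B = ≤∧≢⇒< (up-in-A (vs i) ∈A ∉B) (MA≢MB i ∘ toℕ-injective)
    B⇒mb<ma : ∀ i → vs i ∈ B → vs i ∉ A → mb i < ma i
    B⇒mb<ma i ∈B ∉A = ≤∧≢⇒< (down-in-B (vs i) ∈B ∉A) (MA≢MB i ∘ sym ∘ toℕ-injective)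

  directions-balanced :
    (∀ v → ¬ (v ∈△ (A , B)) → ∣ toℕ (MA v) - toℕ (MB v) ∣ ≤ 1) →
    ¬ (∃[ v₁ ] ∃[ v₂ ] (v₁ ∈△ (A , B) × v₂ ∈△ (A , B) ×
         (toℕ (MA v₁) ⊓ toℕ (MB v₁) < toℕ (MA v₂) ⊓ toℕ (MB v₂)) ×
         (toℕ (MA v₁) ⊔ toℕ (MB v₁) > toℕ (MA v₂) ⊔ toℕ (MB v₂)))) →
    ∣ ascents - descents ∣ ≤ 1
  directions-balanced near-outside unnested =
    [ (λ forward → oriented-directions-balanced long {MA} {MB} MA-injective forward short-unit long-unnested)
    , (λ backward → subst (_≤ 1) (∣-∣-comm descents ascents)
                          (oriented-directions-balanced long {MB} {MA} MB-injective backward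
                                                        short-unit′ long-unnested′))
    ]′ orientation
    where
    short-unit : ∀ i → long i ≡ false → ∣ ma i - mb i ∣ ≤ 1
    short-unit i short = near-outside (vs i) (xor-false⇒∉△ (vs i ∈? A) (vs i ∈? B) short)
    long-unnested : ∀ i j → long i ≡ true → long j ≡ true → ¬ (ma i ⊓ mb i < ma j ⊓ mb j × ma j ⊔ mb j < ma i ⊔ mb i)
    long-unnested i j long-i long-j (lo< , hi<) =
      unnested (vs i , vs j , xor-true⇒∈△ (vs i ∈? A) (vs i ∈? B) long-i ,
                xor-true⇒∈△ (vs j ∈? A) (vs j ∈? B) long-j , lo< , hi<)
    short-unit′ : ∀ i → long i ≡ false → ∣ mb i - ma i ∣ ≤ 1
    short-unit′ i short = subst (_≤ 1) (∣-∣-comm (ma i) (mb i)) (short-unit i short)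
    long-unnested′ : ∀ i j → long i ≡ true → long j ≡ true → ¬ (mb i ⊓ ma i < mb j ⊓ ma j × mb j ⊔ ma j < mb i ⊔ ma i)
    long-unnested′ i j
      rewrite ⊓-comm (mb i) (ma i) | ⊓-comm (mb j) (ma j) | ⊔-comm (mb i) (ma i) | ⊔-comm (mb j) (ma j) =
      long-unnested i j

lemma3p15 : (n : ℕ) (A B : Subset n) (MA MB : Fin n → Fin n) →
    Bijective _≡_ _≡_ MA → Bijective _≡_ _≡_ MB →
    (∀ v → ¬ (v ∈△ (A , B)) → ∣ toℕ (MA v) - toℕ (MB v) ∣ ≤ 1) →
    (∀ v → v ∈ A → v ∉ B → toℕ (MA v) ≤ toℕ (MB v)) →
    (∀ v → v ∈ B → v ∉ A → toℕ (MB v) ≤ toℕ (MA v)) →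
    ¬ (∃[ v₁ ] ∃[ v₂ ] (v₁ ∈△ (A , B) × v₂ ∈△ (A , B) ×
    (toℕ (MA v₁) ⊓ toℕ (MB v₁) < toℕ (MA v₂) ⊓ toℕ (MB v₂)) ×
    (toℕ (MA v₁) ⊔ toℕ (MB v₁) > toℕ (MA v₂) ⊔ toℕ (MB v₂)))) →
    (C : Cycle (InSymDiffEdge MA MB)) →
    ∣ countIn A C - countIn B C ∣ ≤ 1
lemma3p15 n A B MA MB MA-bijective MB-bijective near-outside up-in-A down-in-B unnested C = begin
  ∣ countIn A C - countIn B C ∣  ≡⟨ countIn-difference up-in-A down-in-B ⟩
  ∣ ascents - descents ∣         ≤⟨ directions-balanced near-outside unnested ⟩
  1                              ∎
  where
  open SymmetricDifferenceCycle A B (proj₁ MA-bijective) (proj₁ MB-bijective) C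
  open ≤-Reasoning
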